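{- For all $a,b,c\in\{ -2,-1,0,1\}$, the group $W$ acts transitively on the set $\{(e_1,e_2,e_3)\in E^3 : e_1\cdot e_2=a,\ e_2\cdot e_3=b,\ e_1\cdot e_3=c\}$ whenever this set is nonempty.
   Context: $\Lambda=\{a\in \mathbb{Z}^8+\langle(\tfrac12,\ldots,\tfrac12)\rangle : \sum_i a_i\in 2\mathbb{Z}\}$ is the $E_8$ lattice, $E=\{a\in\Lambda:\|a\|=\sqrt2\}$ its root system, and $W$ the Weyl group of $E_8$ (equal to the automorphism group of $\Lambda$), acting componentwise on tuples of roots. -}

module Defs where

open import Data.Nat using (ℕ)
open import Data.Integer using (ℤ; +_; -[1+_]; _+_; _-_; _*_; _/_)
open import Data.Integer.Divisibility using (_∣_)
open import Data.Vec using (Vec; zipWith; map; foldr)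
open import Data.Vec.Relation.Unary.All using (All)
open import Data.List using (List; _∷_; [])
import Data.List.Relation.Unary.All as L
open import Data.Product using (_×_; _,_)
open import Data.Sum using (_⊎_)
open import Relation.Binary.PropositionalEquality using (_≡_)

-- Convention: a vector a ∈ ℝ^8 whose coordinates lie in ½ℤ is represented by
-- the DOUBLED vector X = 2a ∈ ℤ^8.  Then
--   a ∈ Λ   ⇔  (all X_i even or all X_i odd) and Σ X_i ≡ 0 (mod 4),
--   a · b   =  (X · Y) / 4.
V : Set
V = Vec ℤ 8

sumℤ : ∀ {n} → Vec ℤ n → ℤ
sumℤ = foldr _ _+_ (+ 0)

dot : V → V → ℤ
dot X Y = sumℤ (zipWith _*_ X Y)

InΛ : V → Set
InΛ X = (All (λ x → + 2 ∣ x) X ⊎ All (λ x → + 2 ∣ (x + + 1)) X) × (+ 4 ∣ sumℤ X)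

-- the root system E = { a ∈ Λ : ‖a‖² = 2 }  (4·2 = 8 in doubled coordinates)
IsRoot : V → Set
IsRoot X = InΛ X × dot X X ≡ + 8

-- reflection s_r(x) = x - (x·r) r  (for ‖r‖² = 2), in doubled coordinates:
-- 2 s_r(x) = X - ((X·R)/4) R.  On Λ the division by 4 is exact.
reflect : V → V → V
reflect R X = zipWith _-_ X (map ((dot X R / + 4) *_) R)

-- The Weyl group W is generated by the root reflections; an element of W is
-- represented by a word (list) of roots r₁ … r_k, acting as s_{r₁} ∘ … ∘ s_{r_k}.
WeylWord : Set
WeylWord = List V

IsWeylWord : WeylWord → Set
IsWeylWord = L.All IsRoot

act : WeylWord → V → V
act [] X = X
act (R ∷ w) X = reflect R (act w X)

Triple : Set
Triple = V × V × V

actTriple : WeylWord → Triple → Triple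
actTriple w (X₁ , X₂ , X₃) = act w X₁ , act w X₂ , act w X₃

InT : ℤ → ℤ → ℤ → Triple → Set
InT a b c (X₁ , X₂ , X₃) =
  IsRoot X₁ × IsRoot X₂ × IsRoot X₃ ×
  dot X₁ X₂ ≡ + 4 * a × dot X₂ X₃ ≡ + 4 * b × dot X₁ X₃ ≡ + 4 * c

values : List ℤ
values = -[1+ 1 ] ∷ -[1+ 0 ] ∷ + 0 ∷ + 1 ∷ []

module Submission where

-- We show that every triple (X₁, X₂, X₃) of roots is moved by an
-- explicit product of simple reflections to a normal form that depends only
-- on its Gram data g = (X₁·X₂, X₂·X₃, X₁·X₃).  Then for two triples t, s with
-- the same Gram data, w_t moves t and w_s moves s to the same normal form, so
-- (reverse w_s) · w_t moves t to s.  The normal form is found in three stages: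
-- reduce X₁ by all simple reflections to the dominant root θ; reduce X₂ by the
-- simple reflections fixing θ (they generate its stabiliser, of type E₇) to a
-- representative depending only on θ·X₂; reduce X₃ by those simple reflections
-- that also fix this representative.  Each stage is a greedy descent whose
-- outcome is verified by a finite computation over the 240 roots.

open import Defs
open import Data.Integer using (ℤ)
open import Data.List.Membership.Propositional using (_∈_)
open import Data.Product using (Σ; _×_)
open import Relation.Binary.PropositionalEquality using (_≡_)

open import Data.Nat as ℕ using (ℕ; zero; suc; z≤n; s≤s)
import Data.Nat.Properties as ℕP
import Data.Nat.Divisibility as ℕD
open import Data.Integer as Z using (+_; -[1+_]; _+_; _-_; _*_; _/_; -_; ∣_∣; 0ℤ; 1ℤ; -1ℤ)
import Data.Integer.Properties as ZP
open import Data.Integer.Divisibility using (_∣_)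
open import Data.Integer.Tactic.RingSolver using (solve-∀)
open import Data.Vec as Vec using (Vec; []; _∷_)
import Data.Vec.Properties as VecP
import Data.Vec.Relation.Unary.All as VAll
open import Data.List as List using (List; []; _∷_; _++_)
import Data.List.Properties as ListP
import Data.List.Relation.Unary.All as All
import Data.List.Relation.Unary.All.Properties as AllP
import Data.List.Relation.Unary.Any.Properties as AnyP
open import Data.List.Relation.Unary.Any using (here; there)
import Data.List.Membership.Propositional.Properties as ∈P
open import Data.List.Membership.DecPropositional Z._≟_ using () renaming (_∈?_ to _∈ℤ?_)
open import Data.Maybe using (Maybe; just; nothing)
open import Data.Product using (_,_; proj₁; proj₂)
open import Data.Sum using (inj₁; inj₂; _⊎_)
open import Data.Empty using (⊥-elim)
open import Function using (_∘_)
open import Relation.Nullary using (Dec; yes; no)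
open import Relation.Nullary.Decidable using (from-yes; from-no; _×-dec_; _⊎-dec_)
open import Relation.Binary.PropositionalEquality using (refl; sym; trans; cong; cong₂; subst; module ≡-Reasoning)

2ℤ -2ℤ : ℤ
2ℤ = + 2
-2ℤ = -[1+ 1 ]

infix 8 _·_
_·_ : ∀ {n} → Vec ℤ n → Vec ℤ n → ℤ
X · Y = sumℤ (Vec.zipWith _*_ X Y)

-- X − k R.  A reflection is `shift` with k = (X·R)/4, see `reflect` in Defs.
shift : ∀ {n} → ℤ → Vec ℤ n → Vec ℤ n → Vec ℤ n
shift k X R = Vec.zipWith _-_ X (Vec.map (k *_) R)

·-comm : ∀ {n} (X Y : Vec ℤ n) → X · Y ≡ Y · X
·-comm [] [] = refl
·-comm (x ∷ X) (y ∷ Y) = cong₂ _+_ (ZP.*-comm x y) (·-comm X Y)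

shift-·ˡ : ∀ {n} k (X R Y : Vec ℤ n) → shift k X R · Y ≡ X · Y - k * (R · Y)
shift-·ˡ k [] [] [] = empty k
  where
  empty : ∀ k → 0ℤ ≡ 0ℤ - k * 0ℤ
  empty = solve-∀
shift-·ˡ k (x ∷ X) (r ∷ R) (y ∷ Y) =
  trans (cong (λ s → (x - k * r) * y + s) (shift-·ˡ k X R Y)) (regroup x r y k (X · Y) (R · Y))
  where
  regroup : ∀ x r y k a b → (x - k * r) * y + (a - k * b) ≡ (x * y + a) - k * (r * y + b)
  regroup = solve-∀

shift-·ʳ : ∀ {n} k (X Y R : Vec ℤ n) → X · shift k Y R ≡ X · Y - k * (X · R)
shift-·ʳ k X Y R = begin
  X · shift k Y R          ≡⟨ ·-comm X (shift k Y R) ⟩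
  shift k Y R · X          ≡⟨ shift-·ˡ k Y R X ⟩
  Y · X - k * (R · X)      ≡⟨ cong₂ (λ a b → a - k * b) (·-comm Y X) (·-comm R X) ⟩
  X · Y - k * (X · R)      ∎
  where open ≡-Reasoning

shift-isometry : ∀ {n} (R X Y : Vec ℤ n) kx ky → R · R ≡ + 8 →
  X · R ≡ + 4 * kx → Y · R ≡ + 4 * ky → shift kx X R · shift ky Y R ≡ X · Y
shift-isometry R X Y kx ky hR hX hY = begin
  shift kx X R · shift ky Y R
    ≡⟨ shift-·ˡ kx X R (shift ky Y R) ⟩
  X · shift ky Y R - kx * (R · shift ky Y R)
    ≡⟨ cong₂ (λ a b → a - kx * b) (shift-·ʳ ky X Y R) (shift-·ʳ ky R Y R) ⟩
  (X · Y - ky * (X · R)) - kx * (R · Y - ky * (R · R))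
    ≡⟨ cong (λ a → (X · Y - ky * a) - kx * (R · Y - ky * (R · R))) hX ⟩
  (X · Y - ky * (+ 4 * kx)) - kx * (R · Y - ky * (R · R))
    ≡⟨ cong₂ (λ b c → (X · Y - ky * (+ 4 * kx)) - kx * (b - ky * c)) (trans (·-comm R Y) hY) hR ⟩
  (X · Y - ky * (+ 4 * kx)) - kx * (+ 4 * ky - ky * + 8)
    ≡⟨ cancel (X · Y) kx ky ⟩
  X · Y ∎
  where
  open ≡-Reasoning
  cancel : ∀ d kx ky → (d - ky * (+ 4 * kx)) - kx * (+ 4 * ky - ky * + 8) ≡ d
  cancel = solve-∀

shift-inverse : ∀ {n} k (X R : Vec ℤ n) → shift (- k) (shift k X R) R ≡ X
shift-inverse k [] [] = refl
shift-inverse k (x ∷ X) (r ∷ R) = cong₂ _∷_ (undo x k r) (shift-inverse k X R)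
  where
  undo : ∀ x k r → (x - k * r) - (- k) * r ≡ x
  undo = solve-∀

shift-zero : ∀ {n} (X R : Vec ℤ n) → shift 0ℤ X R ≡ X
shift-zero [] [] = refl
shift-zero (x ∷ X) (r ∷ R) = cong₂ _∷_ (ZP.+-identityʳ x) (shift-zero X R)

-- The pairing X·R of the underlying vectors is an integer, so that the
-- division by 4 in `reflect R X` is exact.
Integral : V → V → Set
Integral X R = dot X R ≡ + 4 * (dot X R / + 4)

reflect-isometry : ∀ {R X Y} → dot R R ≡ + 8 → Integral X R → Integral Y R →
  dot (reflect R X) (reflect R Y) ≡ dot X Y
reflect-isometry {R} {X} {Y} = shift-isometry R X Y _ _

-- A reflection is an involution: X·R changes sign, so the second shift undoes the first.
reflect-involutive : ∀ {R X} → dot R R ≡ + 8 → Integral X R → Integral (reflect R X) R →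
  reflect R (reflect R X) ≡ X
reflect-involutive {R} {X} hR hX hY =
  trans (cong (λ k′ → shift k′ (reflect R X) R) negated) (shift-inverse k X R)
  where
  k = dot X R / + 4
  opposite : ∀ k → + 4 * k - k * + 8 ≡ + 4 * (- k)
  opposite = solve-∀
  fourfold : + 4 * (dot (reflect R X) R / + 4) ≡ + 4 * (- k)
  fourfold = begin
    + 4 * (dot (reflect R X) R / + 4)  ≡⟨ sym hY ⟩
    dot (reflect R X) R                ≡⟨ shift-·ˡ k X R R ⟩
    dot X R - k * dot R R              ≡⟨ cong₂ (λ a b → a - k * b) hX hR ⟩
    + 4 * k - k * + 8                  ≡⟨ opposite k ⟩
    + 4 * (- k)                        ∎
    where open ≡-Reasoning
  negated : dot (reflect R X) R / + 4 ≡ - k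
  negated = ZP.*-cancelˡ-≡ (+ 4) _ _ fourfold

reflect-orthogonal : ∀ {R X} → dot X R ≡ 0ℤ → reflect R X ≡ X
reflect-orthogonal {R} {X} h = trans (cong (λ d → shift (d / + 4) X R) h) (shift-zero X R)

isRoot? : (X : V) → Dec (IsRoot X)
isRoot? X =
  ((VAll.all? (λ x → 2 ℕD.∣? ∣ x ∣) X ⊎-dec VAll.all? (λ x → 2 ℕD.∣? ∣ x + 1ℤ ∣) X)
    ×-dec 4 ℕD.∣? ∣ sumℤ X ∣)
  ×-dec dot X X Z.≟ + 8

vectorsOver : (n : ℕ) → List ℤ → List (Vec ℤ n)
vectorsOver zero    S = [] ∷ []
vectorsOver (suc n) S = List.cartesianProductWith _∷_ S (vectorsOver n S)

∈-vectorsOver : ∀ {n S} {v : Vec ℤ n} → VAll.All (_∈ S) v → v ∈ vectorsOver n S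
∈-vectorsOver VAll.[]             = here refl
∈-vectorsOver (x∈S VAll.∷ v∈Sⁿ) = ∈P.∈-cartesianProductWith⁺ _∷_ x∈S (∈-vectorsOver v∈Sⁿ)

evenValues oddValues : List ℤ
evenValues = -2ℤ ∷ 0ℤ ∷ 2ℤ ∷ []
oddValues  = -1ℤ ∷ 1ℤ ∷ []

normℕ : ∀ {n} → Vec ℤ n → ℕ
normℕ []      = 0
normℕ (x ∷ v) = ∣ x ∣ ℕ.* ∣ x ∣ ℕ.+ normℕ v

square-abs : ∀ x → x * x ≡ + (∣ x ∣ ℕ.* ∣ x ∣)
square-abs (+ n)    = ZP.+◃n≡+n (n ℕ.* n)
square-abs -[1+ n ] = refl

·-self : ∀ {n} (v : Vec ℤ n) → v · v ≡ + normℕ v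
·-self []      = refl
·-self (x ∷ v) =
  trans (cong₂ _+_ (square-abs x) (·-self v)) (sym (ZP.pos-+ (∣ x ∣ ℕ.* ∣ x ∣) (normℕ v)))

coordinate-bound : ∀ {n} (v : Vec ℤ n) → VAll.All (λ x → ∣ x ∣ ℕ.* ∣ x ∣ ℕ.≤ normℕ v) v
coordinate-bound []      = VAll.[]
coordinate-bound (x ∷ v) =
  ℕP.m≤m+n _ _ VAll.∷ VAll.map (λ h → ℕP.≤-trans h (ℕP.m≤n+m _ _)) (coordinate-bound v)

abs-at-most-2 : ∀ m → m ℕ.* m ℕ.≤ 8 → m ℕ.≤ 2
abs-at-most-2 0 _ = z≤n
abs-at-most-2 1 _ = s≤s z≤n
abs-at-most-2 2 _ = s≤s (s≤s z≤n)
abs-at-most-2 m@(suc (suc (suc _))) m²≤8 = ⊥-elim (ℕP.<-irrefl refl (ℕP.≤-trans 9≤m² m²≤8))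
  where
  3≤m : 3 ℕ.≤ m
  3≤m = s≤s (s≤s (s≤s z≤n))
  9≤m² : 9 ℕ.≤ m ℕ.* m
  9≤m² = ℕP.*-mono-≤ 3≤m 3≤m

small-coordinates : ∀ {n} (v : Vec ℤ n) → v · v ≡ + 8 → VAll.All (λ x → ∣ x ∣ ℕ.≤ 2) v
small-coordinates v v·v≡8 =
  VAll.map (abs-at-most-2 _ ∘ subst (_ ℕ.≤_) norm≡8) (coordinate-bound v)
  where
  norm≡8 : normℕ v ≡ 8
  norm≡8 = ZP.+-injective (trans (sym (·-self v)) v·v≡8)

even-coordinate : ∀ x → ∣ x ∣ ℕ.≤ 2 → + 2 ∣ x → x ∈ evenValues
even-coordinate (+ 0)                 _ _   = there (here refl)
even-coordinate (+ 1)                 _ 2∣1 = ⊥-elim (from-no (2 ℕD.∣? 1) 2∣1)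
even-coordinate (+ 2)                 _ _   = there (there (here refl))
even-coordinate (+ suc (suc (suc _))) (s≤s (s≤s ())) _
even-coordinate -[1+ 0 ]              _ 2∣1 = ⊥-elim (from-no (2 ℕD.∣? 1) 2∣1)
even-coordinate -[1+ 1 ]              _ _   = here refl
even-coordinate -[1+ suc (suc _) ]    (s≤s (s≤s ())) _

odd-coordinate : ∀ x → ∣ x ∣ ℕ.≤ 2 → + 2 ∣ (x + 1ℤ) → x ∈ oddValues
odd-coordinate (+ 0)                 _ 2∣1 = ⊥-elim (from-no (2 ℕD.∣? 1) 2∣1)
odd-coordinate (+ 1)                 _ _   = there (here refl)
odd-coordinate (+ 2)                 _ 2∣3 = ⊥-elim (from-no (2 ℕD.∣? 3) 2∣3)
odd-coordinate (+ suc (suc (suc _))) (s≤s (s≤s ())) _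
odd-coordinate -[1+ 0 ]              _ _   = here refl
odd-coordinate -[1+ 1 ]              _ 2∣1 = ⊥-elim (from-no (2 ℕD.∣? 1) 2∣1)
odd-coordinate -[1+ suc (suc _) ]    (s≤s (s≤s ())) _

root-coordinates : ∀ {X} → IsRoot X →
  VAll.All (_∈ evenValues) X ⊎ VAll.All (_∈ oddValues) X
root-coordinates {X} ((inj₁ even , _) , X·X≡8) =
  inj₁ (VAll.map (λ (b , e) → even-coordinate _ b e) (VAll.zip (small-coordinates X X·X≡8 , even)))
root-coordinates {X} ((inj₂ odd , _) , X·X≡8) =
  inj₂ (VAll.map (λ (b , o) → odd-coordinate _ b o) (VAll.zip (small-coordinates X X·X≡8 , odd)))

candidates : (n : ℕ) → List (Vec ℤ n)
candidates n = vectorsOver n evenValues ++ vectorsOver n oddValues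

∈-candidates : ∀ {n} {X : Vec ℤ n} →
  VAll.All (_∈ evenValues) X ⊎ VAll.All (_∈ oddValues) X → X ∈ candidates n
∈-candidates     (inj₁ even) = ∈P.∈-++⁺ˡ (∈-vectorsOver even)
∈-candidates {n} (inj₂ odd)  = ∈P.∈-++⁺ʳ (vectorsOver n evenValues) (∈-vectorsOver odd)

rootsAmong : List V → List V
rootsAmong = List.filter isRoot?

∈rootsAmong⁺ : ∀ xs {X} → X ∈ xs → IsRoot X → X ∈ rootsAmong xs
∈rootsAmong⁺ xs = ∈P.∈-filter⁺ isRoot? {xs = xs}

roots : List V
roots = rootsAmong (candidates 8)

root⇒∈roots : ∀ {X} → IsRoot X → X ∈ roots
root⇒∈roots r = ∈rootsAmong⁺ (candidates 8) (∈-candidates (root-coordinates r)) r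

-- Bourbaki's simple roots α₁, …, α₈ of E₈, and the highest root θ = e₇ + e₈,
-- which is the unique dominant root.
simpleRoots : List V
simpleRoots =
    (1ℤ ∷ -1ℤ ∷ -1ℤ ∷ -1ℤ ∷ -1ℤ ∷ -1ℤ ∷ -1ℤ ∷ 1ℤ ∷ [])
  ∷ (2ℤ ∷ 2ℤ ∷ 0ℤ ∷ 0ℤ ∷ 0ℤ ∷ 0ℤ ∷ 0ℤ ∷ 0ℤ ∷ [])
  ∷ (-2ℤ ∷ 2ℤ ∷ 0ℤ ∷ 0ℤ ∷ 0ℤ ∷ 0ℤ ∷ 0ℤ ∷ 0ℤ ∷ [])
  ∷ (0ℤ ∷ -2ℤ ∷ 2ℤ ∷ 0ℤ ∷ 0ℤ ∷ 0ℤ ∷ 0ℤ ∷ 0ℤ ∷ [])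
  ∷ (0ℤ ∷ 0ℤ ∷ -2ℤ ∷ 2ℤ ∷ 0ℤ ∷ 0ℤ ∷ 0ℤ ∷ 0ℤ ∷ [])
  ∷ (0ℤ ∷ 0ℤ ∷ 0ℤ ∷ -2ℤ ∷ 2ℤ ∷ 0ℤ ∷ 0ℤ ∷ 0ℤ ∷ [])
  ∷ (0ℤ ∷ 0ℤ ∷ 0ℤ ∷ 0ℤ ∷ -2ℤ ∷ 2ℤ ∷ 0ℤ ∷ 0ℤ ∷ [])
  ∷ (0ℤ ∷ 0ℤ ∷ 0ℤ ∷ 0ℤ ∷ 0ℤ ∷ -2ℤ ∷ 2ℤ ∷ 0ℤ ∷ [])
  ∷ []

θ : V
θ = 0ℤ ∷ 0ℤ ∷ 0ℤ ∷ 0ℤ ∷ 0ℤ ∷ 0ℤ ∷ 2ℤ ∷ 2ℤ ∷ []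

-- Wrapping a
-- computed vector in it before a decision procedure makes the evaluator
-- compute each coordinate once instead of once per use.
evaluated : ∀ {n} → Vec ℤ n → Vec ℤ n
evaluated = Vec.map λ { (+ n) → + n ; -[1+ n ] → -[1+ n ] }

evaluated-id : ∀ {n} (v : Vec ℤ n) → evaluated v ≡ v
evaluated-id []             = refl
evaluated-id (+ n ∷ v)      = cong (+ n ∷_) (evaluated-id v)
evaluated-id (-[1+ n ] ∷ v) = cong (-[1+ n ] ∷_) (evaluated-id v)

abstract
  simpleRoots-areRoots : All.All IsRoot simpleRoots
  simpleRoots-areRoots = from-yes (All.all? isRoot? simpleRoots)

abstract
  simpleReflections-onRoots :
    All.All (λ X → All.All (λ R → IsRoot (evaluated (reflect R X)) × Integral X R) simpleRoots) roots
  simpleReflections-onRoots = from-yes (All.all? (λ X → All.all? (λ R →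
    isRoot? (evaluated (reflect R X)) ×-dec dot X R Z.≟ + 4 * (dot X R / + 4)) simpleRoots) roots)

simple-norm : ∀ {R} → R ∈ simpleRoots → dot R R ≡ + 8
simple-norm R∈S = proj₂ (All.lookup simpleRoots-areRoots R∈S)

simple-integral : ∀ {R X} → R ∈ simpleRoots → X ∈ roots → Integral X R
simple-integral R∈S X∈E = proj₂ (All.lookup (All.lookup simpleReflections-onRoots X∈E) R∈S)

simple-reflect-root : ∀ {R X} → R ∈ simpleRoots → X ∈ roots → reflect R X ∈ roots
simple-reflect-root R∈S X∈E =
  subst (_∈ roots) (evaluated-id _)
    (root⇒∈roots (proj₁ (All.lookup (All.lookup simpleReflections-onRoots X∈E) R∈S)))

-- Words in the simple reflections; they generate W, and we only ever need these.
SimpleWord : WeylWord → Set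
SimpleWord = All.All (_∈ simpleRoots)

simpleWord-isWeylWord : ∀ {w} → SimpleWord w → IsWeylWord w
simpleWord-isWeylWord = All.map (All.lookup simpleRoots-areRoots)

act-++ : ∀ u v X → act (u ++ v) X ≡ act u (act v X)
act-++ []      v X = refl
act-++ (R ∷ u) v X = cong (reflect R) (act-++ u v X)

act-root : ∀ {w X} → SimpleWord w → X ∈ roots → act w X ∈ roots
act-root All.[]           X∈E = X∈E
act-root (R∈S All.∷ w∈S) X∈E = simple-reflect-root R∈S (act-root w∈S X∈E)

act-isometry : ∀ {w X Y} → SimpleWord w → X ∈ roots → Y ∈ roots →
  dot (act w X) (act w Y) ≡ dot X Y
act-isometry All.[]           X∈E Y∈E = refl
act-isometry {R ∷ w} {X} {Y} (R∈S All.∷ w∈S) X∈E Y∈E =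
  trans (reflect-isometry {R} {act w X} {act w Y} (simple-norm R∈S)
          (simple-integral R∈S (act-root w∈S X∈E)) (simple-integral R∈S (act-root w∈S Y∈E)))
        (act-isometry w∈S X∈E Y∈E)

-- The reversed word acts as the inverse, each letter being an involution.
act-reverse : ∀ {w X} → SimpleWord w → X ∈ roots → act (List.reverse w) (act w X) ≡ X
act-reverse                  All.[]           X∈E = refl
act-reverse {R ∷ w} {X} (R∈S All.∷ w∈S) X∈E = begin
  act (List.reverse (R ∷ w)) (reflect R Y)        ≡⟨ cong (λ u → act u (reflect R Y)) (ListP.unfold-reverse R w) ⟩
  act (List.reverse w ++ R ∷ []) (reflect R Y)    ≡⟨ act-++ (List.reverse w) (R ∷ []) (reflect R Y) ⟩
  act (List.reverse w) (reflect R (reflect R Y))  ≡⟨ cong (act (List.reverse w)) involution ⟩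
  act (List.reverse w) Y                          ≡⟨ act-reverse w∈S X∈E ⟩
  X                                               ∎
  where
  open ≡-Reasoning
  Y = act w X
  Y∈E = act-root w∈S X∈E
  involution : reflect R (reflect R Y) ≡ Y
  involution = reflect-involutive (simple-norm R∈S)
    (simple-integral R∈S Y∈E) (simple-integral R∈S (simple-reflect-root R∈S Y∈E))

reverse-simpleWord : ∀ {w} → SimpleWord w → SimpleWord (List.reverse w)
reverse-simpleWord w∈S = All.tabulate (All.lookup w∈S ∘ AnyP.reverse⁻)

act-fixes : ∀ {v w} → All.All (λ R → dot v R ≡ 0ℤ) w → act w v ≡ v
act-fixes All.[]          = refl
act-fixes (v⊥R All.∷ v⊥w) = trans (cong (reflect _) (act-fixes v⊥w)) (reflect-orthogonal v⊥R)

-- Reduction to a dominant representative.  `descent S X` is the first root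
-- of S having negative pairing with X, if any; reflecting in it raises X
-- towards the dominant chamber of the reflection group generated by S.
descent : List V → V → Maybe V
descent []      X = nothing
descent (R ∷ S) X with dot X R Z.<? 0ℤ
... | yes _ = just R
... | no  _ = descent S X

descent-∈ : ∀ S X {R} → descent S X ≡ just R → R ∈ S
descent-∈ (R′ ∷ S) X eq with dot X R′ Z.<? 0ℤ
descent-∈ (R′ ∷ S) X refl | yes _ = here refl
descent-∈ (R′ ∷ S) X eq   | no  _ = there (descent-∈ S X eq)

-- Reflect in descents until none is left (or the fuel runs out), recording
-- the reflections used, the latest first as in `act`.
dominate : ℕ → List V → WeylWord → V → WeylWord
dominate zero    S w X = w
dominate (suc n) S w X with descent S X
... | nothing = w
... | just R  = dominate n S (R ∷ w) (reflect R X)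

dominate-over : ∀ n S {w} X → All.All (_∈ S) w → All.All (_∈ S) (dominate n S w X)
dominate-over zero    S X w∈S = w∈S
dominate-over (suc n) S X w∈S with descent S X in eq
... | nothing = w∈S
... | just R  = dominate-over n S (reflect R X) (descent-∈ S X eq All.∷ w∈S)

-- Each step raises the height of a root, and heights range over [-29, 29],
-- so 60 steps suffice for E₈; the outcomes are checked below in any case.
reduceBy : List V → V → WeylWord
reduceBy S X = dominate 60 S [] X

reduceBy-over : ∀ S X → All.All (_∈ S) (reduceBy S X)
reduceBy-over S X = dominate-over 60 S X All.[]

-- `Reduces S target`: reducing any root X by S yields `target X`.  This is
-- decidable, since E is finite; it is how the orbit computations are checked.
Reduces : List V → (V → V) → Set
Reduces S target = All.All (λ X → act (reduceBy S X) X ≡ target X) roots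

reduces? : ∀ S target → Dec (Reduces S target)
reduces? S target =
  All.all? (λ X → VecP.≡-dec Z._≟_ (act (reduceBy S X) X) (target X)) roots

-- The simple roots of S orthogonal to v.  Reflections in them fix v, and they
-- generate the stabiliser of v (a standard parabolic subgroup) when v is
-- dominant for S.
orthogonalTo : V → List V → List V
orthogonalTo v = List.filter (λ R → dot v R Z.≟ 0ℤ)

orthogonal-word : ∀ v S {w} → All.All (_∈ orthogonalTo v S) w →
  All.All (_∈ S) w × All.All (λ R → dot v R ≡ 0ℤ) w
orthogonal-word v S w∈J =
  All.map (proj₁ ∘ member) w∈J , All.map (proj₂ ∘ member) w∈J
  where
  member : ∀ {R} → R ∈ orthogonalTo v S → R ∈ S × dot v R ≡ 0ℤ
  member = ∈P.∈-filter⁻ (λ R → dot v R Z.≟ 0ℤ) {xs = S}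

-- The possible values of θ·X for a root X, in doubled form: 4·{-2, -1, 0, 1, 2}.
-- (Pairings of roots are written this way throughout: -[1+ 7 ] = -8 and
-- -[1+ 3 ] = -4 stand for the inner products -2 and -1.)
θ-pairings : List ℤ
θ-pairings = -[1+ 7 ] ∷ -[1+ 3 ] ∷ 0ℤ ∷ + 4 ∷ + 8 ∷ []

-- Orbit representatives of the stabiliser W_θ on roots, indexed by θ·X
-- (values that do not occur are sent to θ).
secondRep : ℤ → V
secondRep -[1+ 7 ] = 0ℤ ∷ 0ℤ ∷ 0ℤ ∷ 0ℤ ∷ 0ℤ ∷ 0ℤ ∷ -2ℤ ∷ -2ℤ ∷ []
secondRep -[1+ 3 ] = 0ℤ ∷ 0ℤ ∷ 0ℤ ∷ 0ℤ ∷ 0ℤ ∷ 2ℤ ∷ -2ℤ ∷ 0ℤ ∷ []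
secondRep (+ 0)    = 0ℤ ∷ 0ℤ ∷ 0ℤ ∷ 0ℤ ∷ 0ℤ ∷ 0ℤ ∷ -2ℤ ∷ 2ℤ ∷ []
secondRep (+ 4)    = 0ℤ ∷ 0ℤ ∷ 0ℤ ∷ 0ℤ ∷ 0ℤ ∷ 2ℤ ∷ 0ℤ ∷ 2ℤ ∷ []
secondRep (+ 8)    = 0ℤ ∷ 0ℤ ∷ 0ℤ ∷ 0ℤ ∷ 0ℤ ∷ 0ℤ ∷ 2ℤ ∷ 2ℤ ∷ []
secondRep _        = θ

-- Orbit representatives of the stabiliser of (θ, secondRep k) on roots,
-- indexed by k and the pairings of the root with secondRep k and with θ.
-- Pairings that do not occur are sent to θ.
thirdRep : ℤ → ℤ → ℤ → V
thirdRep -[1+ 7 ] -[1+ 7 ] (+ 8) = 0ℤ ∷ 0ℤ ∷ 0ℤ ∷ 0ℤ ∷ 0ℤ ∷ 0ℤ ∷ 2ℤ ∷ 2ℤ ∷ []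
thirdRep -[1+ 7 ] -[1+ 3 ] (+ 4) = 0ℤ ∷ 0ℤ ∷ 0ℤ ∷ 0ℤ ∷ 0ℤ ∷ 2ℤ ∷ 0ℤ ∷ 2ℤ ∷ []
thirdRep -[1+ 7 ] (+ 0) (+ 0) = 0ℤ ∷ 0ℤ ∷ 0ℤ ∷ 0ℤ ∷ 0ℤ ∷ 0ℤ ∷ -2ℤ ∷ 2ℤ ∷ []
thirdRep -[1+ 7 ] (+ 4) -[1+ 3 ] = 0ℤ ∷ 0ℤ ∷ 0ℤ ∷ 0ℤ ∷ 0ℤ ∷ 2ℤ ∷ -2ℤ ∷ 0ℤ ∷ []
thirdRep -[1+ 7 ] (+ 8) -[1+ 7 ] = 0ℤ ∷ 0ℤ ∷ 0ℤ ∷ 0ℤ ∷ 0ℤ ∷ 0ℤ ∷ -2ℤ ∷ -2ℤ ∷ []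
thirdRep -[1+ 3 ] -[1+ 7 ] (+ 4) = 0ℤ ∷ 0ℤ ∷ 0ℤ ∷ 0ℤ ∷ 0ℤ ∷ -2ℤ ∷ 2ℤ ∷ 0ℤ ∷ []
thirdRep -[1+ 3 ] -[1+ 3 ] -[1+ 3 ] = 0ℤ ∷ 0ℤ ∷ 0ℤ ∷ 0ℤ ∷ 0ℤ ∷ -2ℤ ∷ 0ℤ ∷ -2ℤ ∷ []
thirdRep -[1+ 3 ] -[1+ 3 ] (+ 0) = 0ℤ ∷ 0ℤ ∷ 0ℤ ∷ 0ℤ ∷ 2ℤ ∷ -2ℤ ∷ 0ℤ ∷ 0ℤ ∷ []
thirdRep -[1+ 3 ] -[1+ 3 ] (+ 4) = 0ℤ ∷ 0ℤ ∷ 0ℤ ∷ 0ℤ ∷ 0ℤ ∷ -2ℤ ∷ 0ℤ ∷ 2ℤ ∷ []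
thirdRep -[1+ 3 ] -[1+ 3 ] (+ 8) = 0ℤ ∷ 0ℤ ∷ 0ℤ ∷ 0ℤ ∷ 0ℤ ∷ 0ℤ ∷ 2ℤ ∷ 2ℤ ∷ []
thirdRep -[1+ 3 ] (+ 0) -[1+ 3 ] = 0ℤ ∷ 0ℤ ∷ 0ℤ ∷ 0ℤ ∷ 0ℤ ∷ -2ℤ ∷ -2ℤ ∷ 0ℤ ∷ []
thirdRep -[1+ 3 ] (+ 0) (+ 0) = 1ℤ ∷ 1ℤ ∷ 1ℤ ∷ 1ℤ ∷ 1ℤ ∷ -1ℤ ∷ -1ℤ ∷ 1ℤ ∷ []
thirdRep -[1+ 3 ] (+ 0) (+ 4) = 0ℤ ∷ 0ℤ ∷ 0ℤ ∷ 0ℤ ∷ 2ℤ ∷ 0ℤ ∷ 0ℤ ∷ 2ℤ ∷ []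
thirdRep -[1+ 3 ] (+ 4) -[1+ 7 ] = 0ℤ ∷ 0ℤ ∷ 0ℤ ∷ 0ℤ ∷ 0ℤ ∷ 0ℤ ∷ -2ℤ ∷ -2ℤ ∷ []
thirdRep -[1+ 3 ] (+ 4) -[1+ 3 ] = 0ℤ ∷ 0ℤ ∷ 0ℤ ∷ 0ℤ ∷ 2ℤ ∷ 0ℤ ∷ -2ℤ ∷ 0ℤ ∷ []
thirdRep -[1+ 3 ] (+ 4) (+ 0) = 0ℤ ∷ 0ℤ ∷ 0ℤ ∷ 0ℤ ∷ 0ℤ ∷ 0ℤ ∷ -2ℤ ∷ 2ℤ ∷ []
thirdRep -[1+ 3 ] (+ 4) (+ 4) = 0ℤ ∷ 0ℤ ∷ 0ℤ ∷ 0ℤ ∷ 0ℤ ∷ 2ℤ ∷ 0ℤ ∷ 2ℤ ∷ []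
thirdRep -[1+ 3 ] (+ 8) -[1+ 3 ] = 0ℤ ∷ 0ℤ ∷ 0ℤ ∷ 0ℤ ∷ 0ℤ ∷ 2ℤ ∷ -2ℤ ∷ 0ℤ ∷ []
thirdRep (+ 0) -[1+ 7 ] (+ 0) = 0ℤ ∷ 0ℤ ∷ 0ℤ ∷ 0ℤ ∷ 0ℤ ∷ 0ℤ ∷ 2ℤ ∷ -2ℤ ∷ []
thirdRep (+ 0) -[1+ 3 ] -[1+ 3 ] = 0ℤ ∷ 0ℤ ∷ 0ℤ ∷ 0ℤ ∷ 0ℤ ∷ 2ℤ ∷ 0ℤ ∷ -2ℤ ∷ []
thirdRep (+ 0) -[1+ 3 ] (+ 0) = -1ℤ ∷ 1ℤ ∷ 1ℤ ∷ 1ℤ ∷ 1ℤ ∷ 1ℤ ∷ 1ℤ ∷ -1ℤ ∷ []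
thirdRep (+ 0) -[1+ 3 ] (+ 4) = 0ℤ ∷ 0ℤ ∷ 0ℤ ∷ 0ℤ ∷ 0ℤ ∷ 2ℤ ∷ 2ℤ ∷ 0ℤ ∷ []
thirdRep (+ 0) (+ 0) -[1+ 7 ] = 0ℤ ∷ 0ℤ ∷ 0ℤ ∷ 0ℤ ∷ 0ℤ ∷ 0ℤ ∷ -2ℤ ∷ -2ℤ ∷ []
thirdRep (+ 0) (+ 0) -[1+ 3 ] = 1ℤ ∷ 1ℤ ∷ 1ℤ ∷ 1ℤ ∷ 1ℤ ∷ 1ℤ ∷ -1ℤ ∷ -1ℤ ∷ []
thirdRep (+ 0) (+ 0) (+ 0) = 0ℤ ∷ 0ℤ ∷ 0ℤ ∷ 0ℤ ∷ 2ℤ ∷ 2ℤ ∷ 0ℤ ∷ 0ℤ ∷ []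
thirdRep (+ 0) (+ 0) (+ 4) = 1ℤ ∷ 1ℤ ∷ 1ℤ ∷ 1ℤ ∷ 1ℤ ∷ 1ℤ ∷ 1ℤ ∷ 1ℤ ∷ []
thirdRep (+ 0) (+ 0) (+ 8) = 0ℤ ∷ 0ℤ ∷ 0ℤ ∷ 0ℤ ∷ 0ℤ ∷ 0ℤ ∷ 2ℤ ∷ 2ℤ ∷ []
thirdRep (+ 0) (+ 4) -[1+ 3 ] = 0ℤ ∷ 0ℤ ∷ 0ℤ ∷ 0ℤ ∷ 0ℤ ∷ 2ℤ ∷ -2ℤ ∷ 0ℤ ∷ []
thirdRep (+ 0) (+ 4) (+ 0) = -1ℤ ∷ 1ℤ ∷ 1ℤ ∷ 1ℤ ∷ 1ℤ ∷ 1ℤ ∷ -1ℤ ∷ 1ℤ ∷ []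
thirdRep (+ 0) (+ 4) (+ 4) = 0ℤ ∷ 0ℤ ∷ 0ℤ ∷ 0ℤ ∷ 0ℤ ∷ 2ℤ ∷ 0ℤ ∷ 2ℤ ∷ []
thirdRep (+ 0) (+ 8) (+ 0) = 0ℤ ∷ 0ℤ ∷ 0ℤ ∷ 0ℤ ∷ 0ℤ ∷ 0ℤ ∷ -2ℤ ∷ 2ℤ ∷ []
thirdRep (+ 4) -[1+ 7 ] -[1+ 3 ] = 0ℤ ∷ 0ℤ ∷ 0ℤ ∷ 0ℤ ∷ 0ℤ ∷ -2ℤ ∷ 0ℤ ∷ -2ℤ ∷ []
thirdRep (+ 4) -[1+ 3 ] -[1+ 7 ] = 0ℤ ∷ 0ℤ ∷ 0ℤ ∷ 0ℤ ∷ 0ℤ ∷ 0ℤ ∷ -2ℤ ∷ -2ℤ ∷ []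
thirdRep (+ 4) -[1+ 3 ] -[1+ 3 ] = 0ℤ ∷ 0ℤ ∷ 0ℤ ∷ 0ℤ ∷ 0ℤ ∷ -2ℤ ∷ -2ℤ ∷ 0ℤ ∷ []
thirdRep (+ 4) -[1+ 3 ] (+ 0) = 0ℤ ∷ 0ℤ ∷ 0ℤ ∷ 0ℤ ∷ 2ℤ ∷ -2ℤ ∷ 0ℤ ∷ 0ℤ ∷ []
thirdRep (+ 4) -[1+ 3 ] (+ 4) = 0ℤ ∷ 0ℤ ∷ 0ℤ ∷ 0ℤ ∷ 0ℤ ∷ -2ℤ ∷ 2ℤ ∷ 0ℤ ∷ []
thirdRep (+ 4) (+ 0) -[1+ 3 ] = 0ℤ ∷ 0ℤ ∷ 0ℤ ∷ 0ℤ ∷ 2ℤ ∷ 0ℤ ∷ -2ℤ ∷ 0ℤ ∷ []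
thirdRep (+ 4) (+ 0) (+ 0) = 1ℤ ∷ 1ℤ ∷ 1ℤ ∷ 1ℤ ∷ 1ℤ ∷ -1ℤ ∷ -1ℤ ∷ 1ℤ ∷ []
thirdRep (+ 4) (+ 0) (+ 4) = 0ℤ ∷ 0ℤ ∷ 0ℤ ∷ 0ℤ ∷ 0ℤ ∷ -2ℤ ∷ 0ℤ ∷ 2ℤ ∷ []
thirdRep (+ 4) (+ 4) -[1+ 3 ] = 0ℤ ∷ 0ℤ ∷ 0ℤ ∷ 0ℤ ∷ 0ℤ ∷ 2ℤ ∷ -2ℤ ∷ 0ℤ ∷ []
thirdRep (+ 4) (+ 4) (+ 0) = 0ℤ ∷ 0ℤ ∷ 0ℤ ∷ 0ℤ ∷ 0ℤ ∷ 0ℤ ∷ -2ℤ ∷ 2ℤ ∷ []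
thirdRep (+ 4) (+ 4) (+ 4) = 0ℤ ∷ 0ℤ ∷ 0ℤ ∷ 0ℤ ∷ 2ℤ ∷ 0ℤ ∷ 0ℤ ∷ 2ℤ ∷ []
thirdRep (+ 4) (+ 4) (+ 8) = 0ℤ ∷ 0ℤ ∷ 0ℤ ∷ 0ℤ ∷ 0ℤ ∷ 0ℤ ∷ 2ℤ ∷ 2ℤ ∷ []
thirdRep (+ 4) (+ 8) (+ 4) = 0ℤ ∷ 0ℤ ∷ 0ℤ ∷ 0ℤ ∷ 0ℤ ∷ 2ℤ ∷ 0ℤ ∷ 2ℤ ∷ []
thirdRep (+ 8) -[1+ 7 ] -[1+ 7 ] = 0ℤ ∷ 0ℤ ∷ 0ℤ ∷ 0ℤ ∷ 0ℤ ∷ 0ℤ ∷ -2ℤ ∷ -2ℤ ∷ []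
thirdRep (+ 8) -[1+ 3 ] -[1+ 3 ] = 0ℤ ∷ 0ℤ ∷ 0ℤ ∷ 0ℤ ∷ 0ℤ ∷ 2ℤ ∷ -2ℤ ∷ 0ℤ ∷ []
thirdRep (+ 8) (+ 0) (+ 0) = 0ℤ ∷ 0ℤ ∷ 0ℤ ∷ 0ℤ ∷ 0ℤ ∷ 0ℤ ∷ -2ℤ ∷ 2ℤ ∷ []
thirdRep (+ 8) (+ 4) (+ 4) = 0ℤ ∷ 0ℤ ∷ 0ℤ ∷ 0ℤ ∷ 0ℤ ∷ 2ℤ ∷ 0ℤ ∷ 2ℤ ∷ []
thirdRep (+ 8) (+ 8) (+ 8) = 0ℤ ∷ 0ℤ ∷ 0ℤ ∷ 0ℤ ∷ 0ℤ ∷ 0ℤ ∷ 2ℤ ∷ 2ℤ ∷ []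
thirdRep _ _ _ = θ

-- The stabiliser of θ, generated by the simple roots orthogonal to it (type E₇),
-- and the stabiliser of θ and secondRep k inside it.
J₁ : List V
J₁ = orthogonalTo θ simpleRoots

J₂ : ℤ → List V
J₂ k = orthogonalTo (secondRep k) J₁

abstract
  θ-pairing-values : All.All (λ Y → dot θ Y ∈ θ-pairings) roots
  θ-pairing-values = from-yes (All.all? (λ Y → dot θ Y ∈ℤ? θ-pairings) roots)

abstract
  secondRep-pairing : All.All (λ k → dot θ (secondRep k) ≡ k) θ-pairings
  secondRep-pairing = from-yes (All.all? (λ k → dot θ (secondRep k) Z.≟ k) θ-pairings)

-- Every root is W-conjugate to θ …
abstract
  reduce-to-θ : Reduces simpleRoots (λ _ → θ)
  reduce-to-θ = from-yes (reduces? simpleRoots (λ _ → θ))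

-- … two roots with the same pairing with θ are conjugate under W_θ …
abstract
  reduce-to-second : Reduces J₁ (λ Y → secondRep (dot θ Y))
  reduce-to-second = from-yes (reduces? J₁ (λ Y → secondRep (dot θ Y)))

-- … and two roots with the same pairings with θ and secondRep k are conjugate
-- under the stabiliser of both.
thirdTarget : ℤ → V → V
thirdTarget k Z = thirdRep k (dot (secondRep k) Z) (dot θ Z)

abstract
  reduce-to-third : All.All (λ k → Reduces (J₂ k) (thirdTarget k)) θ-pairings
  reduce-to-third = from-yes (All.all? (λ k → reduces? (J₂ k) (thirdTarget k)) θ-pairings)

RootTriple : Triple → Set
RootTriple (X₁ , X₂ , X₃) = X₁ ∈ roots × X₂ ∈ roots × X₃ ∈ roots

gram : Triple → ℤ × ℤ × ℤ
gram (X₁ , X₂ , X₃) = dot X₁ X₂ , dot X₂ X₃ , dot X₁ X₃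

normalForm : ℤ × ℤ × ℤ → Triple
normalForm (a , b , c) = θ , secondRep a , thirdRep a b c

actTriple-++ : ∀ u v t → actTriple (u ++ v) t ≡ actTriple u (actTriple v t)
actTriple-++ u v (X₁ , X₂ , X₃) =
  cong₂ _,_ (act-++ u v X₁) (cong₂ _,_ (act-++ u v X₂) (act-++ u v X₃))

actTriple-root : ∀ {w t} → SimpleWord w → RootTriple t → RootTriple (actTriple w t)
actTriple-root w∈S (m₁ , m₂ , m₃) = act-root w∈S m₁ , act-root w∈S m₂ , act-root w∈S m₃

gram-invariant : ∀ {w t} → SimpleWord w → RootTriple t → gram (actTriple w t) ≡ gram t
gram-invariant w∈S (m₁ , m₂ , m₃) =
  cong₂ _,_ (act-isometry w∈S m₁ m₂) (cong₂ _,_ (act-isometry w∈S m₂ m₃) (act-isometry w∈S m₁ m₃))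

actTriple-reverse : ∀ {w t} → SimpleWord w → RootTriple t →
  actTriple (List.reverse w) (actTriple w t) ≡ t
actTriple-reverse w∈S (m₁ , m₂ , m₃) =
  cong₂ _,_ (act-reverse w∈S m₁) (cong₂ _,_ (act-reverse w∈S m₂) (act-reverse w∈S m₃))

first-step : ∀ {X₁} X₂ X₃ → X₁ ∈ roots → let w = reduceBy simpleRoots X₁ in
  actTriple w (X₁ , X₂ , X₃) ≡ (θ , act w X₂ , act w X₃)
first-step {X₁} X₂ X₃ m₁ =
  cong (λ Y₁ → Y₁ , act w X₂ , act w X₃) (All.lookup reduce-to-θ m₁)
  where w = reduceBy simpleRoots X₁

second-step : ∀ {Y₂} Y₃ → Y₂ ∈ roots → let w = reduceBy J₁ Y₂ in
  actTriple w (θ , Y₂ , Y₃) ≡ (θ , secondRep (dot θ Y₂) , act w Y₃)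
second-step {Y₂} Y₃ m₂ =
  cong₂ _,_ (act-fixes θ⊥w) (cong (λ Y → Y , act w Y₃) (All.lookup reduce-to-second m₂))
  where
  w = reduceBy J₁ Y₂
  θ⊥w = proj₂ (orthogonal-word θ simpleRoots (reduceBy-over J₁ Y₂))

third-step : ∀ {k Z₃} → k ∈ θ-pairings → Z₃ ∈ roots →
  actTriple (reduceBy (J₂ k) Z₃) (θ , secondRep k , Z₃) ≡ normalForm (gram (θ , secondRep k , Z₃))
third-step {k} {Z₃} k∈ m₃ = begin
  actTriple w (θ , secondRep k , Z₃)
    ≡⟨ cong₂ _,_ (act-fixes θ⊥w) (cong₂ _,_ (act-fixes rep⊥w) reduced) ⟩
  θ , secondRep k , thirdTarget k Z₃
    ≡⟨ cong (λ a → normalForm (a , dot (secondRep k) Z₃ , dot θ Z₃)) (sym (All.lookup secondRep-pairing k∈)) ⟩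
  normalForm (gram (θ , secondRep k , Z₃)) ∎
  where
  open ≡-Reasoning
  w = reduceBy (J₂ k) Z₃
  reduced = All.lookup (All.lookup reduce-to-third k∈) m₃
  w-letters = orthogonal-word (secondRep k) J₁ (reduceBy-over (J₂ k) Z₃)
  rep⊥w = proj₂ w-letters
  θ⊥w = proj₂ (orthogonal-word θ simpleRoots (proj₁ w-letters))

to-normal-form : ∀ {t} → RootTriple t →
  Σ WeylWord (λ w → SimpleWord w × actTriple w t ≡ normalForm (gram t))
to-normal-form {t@(X₁ , X₂ , X₃)} rt@(m₁ , m₂ , m₃) = w₃ ++ w₂ ++ w₁ , simple , (begin
  actTriple (w₃ ++ w₂ ++ w₁) t
    ≡⟨ trans (actTriple-++ w₃ (w₂ ++ w₁) t) (cong (actTriple w₃) (actTriple-++ w₂ w₁ t)) ⟩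
  actTriple w₃ (actTriple w₂ (actTriple w₁ t))
    ≡⟨ cong (actTriple w₃) reduced₂ ⟩
  actTriple w₃ (θ , secondRep k , Z₃)
    ≡⟨ third-step {k} {Z₃} k∈ (act-root w₂-simple (act-root w₁-simple m₃)) ⟩
  normalForm (gram (θ , secondRep k , Z₃))
    ≡⟨ cong normalForm same-gram ⟩
  normalForm (gram t) ∎)
  where
  open ≡-Reasoning
  w₁ = reduceBy simpleRoots X₁
  w₁-simple = reduceBy-over simpleRoots X₁
  Y₂ = act w₁ X₂
  w₂ = reduceBy J₁ Y₂
  w₂-simple = proj₁ (orthogonal-word θ simpleRoots (reduceBy-over J₁ Y₂))
  k = dot θ Y₂
  k∈ = All.lookup θ-pairing-values (act-root w₁-simple m₂)
  Z₃ = act w₂ (act w₁ X₃)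
  w₃ = reduceBy (J₂ k) Z₃
  w₃-simple = proj₁ (orthogonal-word θ simpleRoots
    (proj₁ (orthogonal-word (secondRep k) J₁ (reduceBy-over (J₂ k) Z₃))))
  simple : SimpleWord (w₃ ++ w₂ ++ w₁)
  simple = AllP.++⁺ w₃-simple (AllP.++⁺ w₂-simple w₁-simple)
  reduced₂ : actTriple w₂ (actTriple w₁ t) ≡ (θ , secondRep k , Z₃)
  reduced₂ = trans (cong (actTriple w₂) (first-step {X₁} X₂ X₃ m₁))
                   (second-step {Y₂} (act w₁ X₃) (act-root w₁-simple m₂))
  same-gram : gram (θ , secondRep k , Z₃) ≡ gram t
  same-gram = begin
    gram (θ , secondRep k , Z₃)             ≡⟨ cong gram (sym reduced₂) ⟩
    gram (actTriple w₂ (actTriple w₁ t))    ≡⟨ gram-invariant w₂-simple (actTriple-root w₁-simple rt) ⟩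
    gram (actTriple w₁ t)                   ≡⟨ gram-invariant w₁-simple rt ⟩
    gram t                                  ∎

meet : ∀ {wt ws t s} → SimpleWord ws → RootTriple s →
  actTriple wt t ≡ actTriple ws s → actTriple (List.reverse ws ++ wt) t ≡ s
meet {wt} {ws} {t} {s} ws-simple rs t↦s = begin
  actTriple (List.reverse ws ++ wt) t           ≡⟨ actTriple-++ (List.reverse ws) wt t ⟩
  actTriple (List.reverse ws) (actTriple wt t)  ≡⟨ cong (actTriple (List.reverse ws)) t↦s ⟩
  actTriple (List.reverse ws) (actTriple ws s)  ≡⟨ actTriple-reverse ws-simple rs ⟩
  s                                             ∎
  where open ≡-Reasoning

-- W acts transitively on triples of roots with a given Gram matrix: both are
-- conjugate to the same normal form.
gram-transitive : ∀ {t s} → RootTriple t → RootTriple s → gram t ≡ gram s →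
  Σ WeylWord (λ w → IsWeylWord w × actTriple w t ≡ s)
gram-transitive {t} {s} rt rs same =
  List.reverse ws ++ wt ,
  simpleWord-isWeylWord (AllP.++⁺ (reverse-simpleWord ws-simple) wt-simple) ,
  meet {wt} {ws} ws-simple rs (trans t↦nf (trans (cong normalForm same) (sym s↦nf)))
  where
  wt = proj₁ (to-normal-form rt)
  wt-simple = proj₁ (proj₂ (to-normal-form rt))
  t↦nf = proj₂ (proj₂ (to-normal-form rt))
  ws = proj₁ (to-normal-form rs)
  ws-simple = proj₁ (proj₂ (to-normal-form rs))
  s↦nf = proj₂ (proj₂ (to-normal-form rs))

-- Proposition 3.2.  The transitivity holds for every Gram matrix.
proposition3p2 : (a b c : ℤ) → a ∈ values → b ∈ values → c ∈ values →
    (t s : Triple) → InT a b c t → InT a b c s →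
      Σ WeylWord (λ w → IsWeylWord w × actTriple w t ≡ s)
proposition3p2 a b c _ _ _ (X₁ , X₂ , X₃) (Y₁ , Y₂ , Y₃)
  (rX₁ , rX₂ , rX₃ , X₁₂ , X₂₃ , X₁₃) (rY₁ , rY₂ , rY₃ , Y₁₂ , Y₂₃ , Y₁₃) =
  gram-transitive
    (root⇒∈roots rX₁ , root⇒∈roots rX₂ , root⇒∈roots rX₃)
    (root⇒∈roots rY₁ , root⇒∈roots rY₂ , root⇒∈roots rY₃)
    (cong₂ _,_ (trans X₁₂ (sym Y₁₂)) (cong₂ _,_ (trans X₂₃ (sym Y₂₃)) (trans X₁₃ (sym Y₁₃))))
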